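{- The morphisms $\varphi$ and $\varphi_R$ commute, i.e. $\varphi\circ\varphi_R=\varphi_R\circ\varphi$.
   Context: $\mathbb{N}=\{0,1,2,\ldots\}$ is an alphabet; $x\cdot y$ denotes concatenation. $S^{ -1}$ is the right cyclic shift, $S^{ -1}(xc)=cx$ for a letter $c$; $R$ is word reversal. The morphism $\varphi\colon\mathbb{N}^*\to\mathbb{N}^*$ is defined recursively by $\varphi(h)=S^{ -1}(\varphi^h(00))\cdot(h+1)$ (well defined since $\varphi^h(00)$ involves only $\varphi$ on letters $<h$); e.g. $\varphi(0)=001$, $\varphi(1)=1001002$. The reversed morphism is $\varphi_R=R\circ\varphi\circ R$, i.e. $\varphi_R(c)=R(\varphi(c))$ for each letter $c$. -}

module Defs where

open import Data.Nat using (ℕ; zero; suc)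
open import Data.List using (List; []; _∷_; _++_; [_]; concatMap; reverse; lookup)
open import Function using (_∘_)

Word : Set
Word = List ℕ

-- Right cyclic shift S⁻¹ : S⁻¹(x c) = c x for a letter c (and S⁻¹ ε = ε).
shiftR : Word → Word
shiftR w with reverse w
... | [] = []
... | c ∷ rx = c ∷ reverse rx

-- Index into a table of images (letters outside the table map to ε;
-- this never happens in the construction below).
at : List Word → ℕ → Word
at [] _ = []
at (x ∷ xs) zero = x
at (x ∷ xs) (suc n) = at xs n

applyTable : List Word → Word → Word
applyTable t = concatMap (at t)

iter : ℕ → (Word → Word) → Word → Word
iter zero f w = w
iter (suc n) f w = f (iter n f w)

-- table h = [ φ(0), …, φ(h-1) ], built by the recursion
--   φ(h) = S⁻¹(φ^h(00)) · (h+1),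
-- where φ^h(00) only involves the images of letters < h.
table : ℕ → List Word
table zero = []
table (suc h) = table h ++ [ shiftR (iter h (applyTable (table h)) (0 ∷ 0 ∷ [])) ++ [ suc h ] ]

φ-letter : ℕ → Word
φ-letter h = at (table (suc h)) h

φ : Word → Word
φ = concatMap φ-letter

-- The reversed morphism φ_R = R ∘ φ ∘ R, i.e. φ_R(c) = R(φ(c)).
φR : Word → Word
φR = concatMap (reverse ∘ φ-letter)

-- Every letter has the shape φ(h) = h vₕ h vₕ (h+1), where v₀ = ε and
-- v_{h+1} = φ(vₕ) h vₕ h vₕ. By strong induction on h: then φ^h(0) = vₕ h, so the
-- iterates φ^i(00), i < h, only contain letters < h, where the table defining φ(h)
-- agrees with φ, and S⁻¹(φ^h(00)) = h vₕ h vₕ.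
--
-- φ ∘ φ_R and φ_R ∘ φ agree on a letter c as soon as φ(R(φ(c))) is a palindrome, and
-- φ(R(φ(c))) = (c+1) v (c+1) v (c+2) v (c+1) v (c+1) with v = v_{c+1}. So it suffices
-- that every vₕ is a palindrome. Comparing the two factorisations of
-- φ^{h+1}(0) = φ(vₕ h) = φ^h(001) shows this follows from φ^h(1) = φ_R(vₕ)(h+1), and this
-- identity propagates to h+1 by commutation on the letters of vₕ, which are all < h;
-- a second strong induction closes the loop.
module Submission where

open import Defs
open import Relation.Binary.PropositionalEquality
  using (_≡_; refl; sym; trans; cong; cong₂; subst; module ≡-Reasoning)
open import Function using (_∘_)
open import Data.Nat using (ℕ; zero; suc; _+_; _<_; _≤_; s≤s)
open import Data.Nat.Properties
  using (≤-refl; <⇒≤; <-trans; <-≤-trans; n<1+n; n≤1+n; m<n⇒m<1+n; m≤n⇒m≤1+n; m<1+n⇒m<n∨m≡n; +-comm)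
open import Data.Sum using (inj₁; inj₂)
open import Data.Nat.Induction using (<-rec)
open import Data.Product using (_×_; _,_; proj₁; proj₂)
open import Data.List using ([]; _∷_; _++_; [_]; reverse; concatMap; length)
open import Data.List.Properties
  using (concatMap-++; ++-assoc; ++-identityʳ; reverse-++; reverse-involutive; length-++; ∷ʳ-injectiveˡ; ++-monoid)
open import Data.List.Relation.Unary.All using (All; []; _∷_)
import Data.List.Relation.Unary.All as All
open import Data.List.Relation.Unary.All.Properties using (++⁺; concat⁺; gmap⁺)
import Algebra.Solver.Monoid as MonoidSolver
open MonoidSolver (++-monoid ℕ) using (solve; _⊜_; _⊕_)
open ≡-Reasoning

Palindrome : Word → Set
Palindrome w = reverse w ≡ w

palindrome-sandwich : ∀ {w x} → Palindrome w → Palindrome x → Palindrome (w ++ x ++ w)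
palindrome-sandwich {w} {x} pw px = begin
  reverse (w ++ x ++ w)           ≡⟨ reverse-++ w (x ++ w) ⟩
  reverse (x ++ w) ++ reverse w   ≡⟨ cong (_++ reverse w) (reverse-++ x w) ⟩
  (reverse w ++ reverse x) ++ reverse w
    ≡⟨ cong₂ (λ a b → (a ++ b) ++ a) pw px ⟩
  (w ++ x) ++ w                   ≡⟨ ++-assoc w x w ⟩
  w ++ x ++ w                     ∎

reverse-concatMap : ∀ (f : ℕ → Word) w → reverse (concatMap f w) ≡ concatMap (reverse ∘ f) (reverse w)
reverse-concatMap f [] = refl
reverse-concatMap f (c ∷ w) = begin
  reverse (f c ++ concatMap f w)                 ≡⟨ reverse-++ (f c) (concatMap f w) ⟩
  reverse (concatMap f w) ++ reverse (f c)       ≡⟨ cong₂ _++_ (reverse-concatMap f w) (sym (++-identityʳ _)) ⟩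
  concatMap fR (reverse w) ++ concatMap fR [ c ] ≡⟨ sym (concatMap-++ fR (reverse w) [ c ]) ⟩
  concatMap fR (reverse w ++ [ c ])              ≡⟨ cong (concatMap fR) (sym (reverse-++ [ c ] w)) ⟩
  concatMap fR (reverse (c ∷ w))                 ∎
  where fR = reverse ∘ f

morphism-commutes-with-reversal : ∀ (f : ℕ → Word) w →
  All (λ c → Palindrome (concatMap f (reverse (f c)))) w →
  concatMap f (concatMap (reverse ∘ f) w) ≡ concatMap (reverse ∘ f) (concatMap f w)
morphism-commutes-with-reversal f [] [] = refl
morphism-commutes-with-reversal f (c ∷ w) (pal ∷ pals) = begin
  concatMap f (reverse (f c) ++ concatMap fR w)            ≡⟨ concatMap-++ f (reverse (f c)) (concatMap fR w) ⟩
  concatMap f (reverse (f c)) ++ concatMap f (concatMap fR w)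
    ≡⟨ cong₂ _++_ letter (morphism-commutes-with-reversal f w pals) ⟩
  concatMap fR (f c) ++ concatMap fR (concatMap f w)       ≡⟨ sym (concatMap-++ fR (f c) (concatMap f w)) ⟩
  concatMap fR (f c ++ concatMap f w)                      ∎
  where
  fR = reverse ∘ f
  letter : concatMap f (reverse (f c)) ≡ concatMap fR (f c)
  letter = begin
    concatMap f (reverse (f c))                 ≡⟨ sym pal ⟩
    reverse (concatMap f (reverse (f c)))       ≡⟨ reverse-concatMap f (reverse (f c)) ⟩
    concatMap fR (reverse (reverse (f c)))      ≡⟨ cong (concatMap fR) (reverse-involutive (f c)) ⟩
    concatMap fR (f c)                          ∎

iter-homomorphic : ∀ {f : Word → Word} → (∀ a b → f (a ++ b) ≡ f a ++ f b) →
  ∀ n a b → iter n f (a ++ b) ≡ iter n f a ++ iter n f b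
iter-homomorphic f-++ zero a b = refl
iter-homomorphic {f} f-++ (suc n) a b = trans (cong f (iter-homomorphic f-++ n a b)) (f-++ _ _)

iter-commute : ∀ n (f : Word → Word) w → iter n f (f w) ≡ f (iter n f w)
iter-commute zero f w = refl
iter-commute (suc n) f w = cong f (iter-commute n f w)

iter-cong-on : ∀ {f g : Word → Word} (P : Word → Set) → (∀ w → P w → f w ≡ g w) →
  ∀ n w → (∀ {i} → i < n → P (iter i g w)) → iter n f w ≡ iter n g w
iter-cong-on P f≗g zero w _ = refl
iter-cong-on {f} P f≗g (suc n) w P-iter =
  trans (cong f (iter-cong-on P f≗g n w (P-iter ∘ m<n⇒m<1+n))) (f≗g _ (P-iter ≤-refl))

shiftR-∷ʳ : ∀ w c → shiftR (w ++ [ c ]) ≡ c ∷ w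
shiftR-∷ʳ w c rewrite reverse-++ w [ c ] | reverse-involutive w = refl

at-++ˡ : ∀ xs ys {c} → c < length xs → at (xs ++ ys) c ≡ at xs c
at-++ˡ (x ∷ xs) ys {zero} _ = refl
at-++ˡ (x ∷ xs) ys {suc c} (s≤s c<n) = at-++ˡ xs ys c<n

at-∷ʳ-length : ∀ xs y → at (xs ++ [ y ]) (length xs) ≡ y
at-∷ʳ-length [] y = refl
at-∷ʳ-length (x ∷ xs) y = at-∷ʳ-length xs y

length-table : ∀ h → length (table h) ≡ h
length-table zero = refl
length-table (suc h) = trans (length-++ (table h)) (trans (cong (_+ 1) (length-table h)) (+-comm h 1))

at-table : ∀ h {c} → c < h → at (table h) c ≡ φ-letter c
at-table (suc h) {c} c<1+h with m<1+n⇒m<n∨m≡n c<1+h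
... | inj₁ c<h =
  trans (at-++ˡ (table h) _ (subst (c <_) (sym (length-table h)) c<h)) (at-table h c<h)
... | inj₂ refl = refl

applyTable-table : ∀ h w → All (_< h) w → applyTable (table h) w ≡ φ w
applyTable-table h [] [] = refl
applyTable-table h (c ∷ w) (c<h ∷ w<h) = cong₂ _++_ (at-table h c<h) (applyTable-table h w w<h)

φ-letter-unfold : ∀ h → φ-letter h ≡ shiftR (iter h (applyTable (table h)) (0 ∷ 0 ∷ [])) ++ [ suc h ]
φ-letter-unfold h = subst (λ k → at (table h ++ [ X ]) k ≡ X) (length-table h) (at-∷ʳ-length (table h) X)
  where X = shiftR (iter h (applyTable (table h)) (0 ∷ 0 ∷ [])) ++ [ suc h ]

φ-++ : ∀ a b → φ (a ++ b) ≡ φ a ++ φ b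
φ-++ = concatMap-++ φ-letter

φR-++ : ∀ a b → φR (a ++ b) ≡ φR a ++ φR b
φR-++ = concatMap-++ (reverse ∘ φ-letter)

φ-[_] : ∀ c → φ [ c ] ≡ φ-letter c
φ-[ c ] = ++-identityʳ (φ-letter c)

iter-φ-++ : ∀ n a b → iter n φ (a ++ b) ≡ iter n φ a ++ iter n φ b
iter-φ-++ = iter-homomorphic φ-++

v : ℕ → Word
v zero = []
v (suc h) = φ (v h) ++ h ∷ v h ++ h ∷ v h

Shape : ℕ → Set
Shape h = φ-letter h ≡ h ∷ v h ++ h ∷ v h ++ [ suc h ]

ShapedBelow : ℕ → Set
ShapedBelow h = ∀ {c} → c < h → Shape c

ShapedBelow-≤ : ∀ {i h} → i ≤ h → ShapedBelow h → ShapedBelow i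
ShapedBelow-≤ i≤h shaped c<i = shaped (<-≤-trans c<i i≤h)

φ-letter-bounded : ∀ {c n} → Shape c → All (_< c) (v c) → suc c < n → All (_< n) (φ-letter c)
φ-letter-bounded {c} shape v<c 1+c<n = subst (All (_< _)) (sym shape)
  (c<n ∷ ++⁺ v<n (c<n ∷ ++⁺ v<n (1+c<n ∷ [])))
  where
  c<n = <-trans (n<1+n c) 1+c<n
  v<n = All.map (λ x<c → <-trans x<c c<n) v<c

v-bounded : ∀ h → ShapedBelow h → All (_< h) (v h)
v-bounded = <-rec _ step
  where
  step : ∀ h → (∀ {i} → i < h → ShapedBelow i → All (_< i) (v i)) → ShapedBelow h → All (_< h) (v h)
  step zero _ _ = []
  step (suc h) rec shaped = ++⁺ φv<1+h (n<1+n h ∷ ++⁺ v<1+h (n<1+n h ∷ v<1+h))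
    where
    v-bounded-≤ : ∀ {i} → i ≤ h → All (_< i) (v i)
    v-bounded-≤ i≤h = rec (s≤s i≤h) (ShapedBelow-≤ (m≤n⇒m≤1+n i≤h) shaped)
    v<h = v-bounded-≤ ≤-refl
    v<1+h = All.map m<n⇒m<1+n v<h
    φv<1+h = concat⁺ (gmap⁺ (λ c<h →
      φ-letter-bounded (shaped (m<n⇒m<1+n c<h)) (v-bounded-≤ (<⇒≤ c<h)) (s≤s c<h)) v<h)

φ-v-∷ʳ : ∀ {h} → Shape h → φ (v h ++ [ h ]) ≡ v (suc h) ++ [ suc h ]
φ-v-∷ʳ {h} shape = begin
  φ (v h ++ [ h ])                            ≡⟨ φ-++ (v h) [ h ] ⟩
  φ (v h) ++ φ [ h ]                          ≡⟨ cong (φ (v h) ++_) (trans φ-[ h ] shape) ⟩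
  φ (v h) ++ h ∷ v h ++ h ∷ v h ++ [ suc h ]
    ≡⟨ solve 4 (λ a b c d → a ⊕ (c ⊕ b ⊕ c ⊕ b ⊕ d) ⊜ (a ⊕ c ⊕ b ⊕ c ⊕ b) ⊕ d)
         refl (φ (v h)) (v h) [ h ] [ suc h ] ⟩
  v (suc h) ++ [ suc h ]                      ∎

iter-φ-0 : ∀ h → ShapedBelow h → iter h φ [ 0 ] ≡ v h ++ [ h ]
iter-φ-0 zero _ = refl
iter-φ-0 (suc h) shaped =
  trans (cong φ (iter-φ-0 h (ShapedBelow-≤ (n≤1+n h) shaped))) (φ-v-∷ʳ (shaped ≤-refl))

iter-φ-00 : ∀ h → ShapedBelow h → iter h φ (0 ∷ 0 ∷ []) ≡ (v h ++ [ h ]) ++ (v h ++ [ h ])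
iter-φ-00 h shaped = trans (iter-φ-++ h [ 0 ] [ 0 ]) (cong₂ _++_ (iter-φ-0 h shaped) (iter-φ-0 h shaped))

shape-step : ∀ h → ShapedBelow h → Shape h
shape-step h shaped = begin
  φ-letter h                                                    ≡⟨ φ-letter-unfold h ⟩
  shiftR (iter h (applyTable (table h)) (0 ∷ 0 ∷ [])) ++ [ suc h ]
    ≡⟨ cong (λ w → shiftR w ++ [ suc h ]) (iter-cong-on (All (_< h)) (applyTable-table h) h _ iterates-bounded) ⟩
  shiftR (iter h φ (0 ∷ 0 ∷ [])) ++ [ suc h ]
    ≡⟨ cong (λ w → shiftR w ++ [ suc h ]) (iter-φ-00 h shaped) ⟩
  shiftR ((v h ++ [ h ]) ++ (v h ++ [ h ])) ++ [ suc h ]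
    ≡⟨ cong (λ w → shiftR w ++ [ suc h ]) (solve 2 (λ a b → (a ⊕ b) ⊕ (a ⊕ b) ⊜ ((a ⊕ b) ⊕ a) ⊕ b) refl (v h) [ h ]) ⟩
  shiftR (((v h ++ [ h ]) ++ v h) ++ [ h ]) ++ [ suc h ]        ≡⟨ cong (_++ [ suc h ]) (shiftR-∷ʳ _ h) ⟩
  (h ∷ (v h ++ [ h ]) ++ v h) ++ [ suc h ]
    ≡⟨ solve 3 (λ a b c → (b ⊕ (a ⊕ b) ⊕ a) ⊕ c ⊜ b ⊕ a ⊕ b ⊕ a ⊕ c) refl (v h) [ h ] [ suc h ] ⟩
  h ∷ v h ++ h ∷ v h ++ [ suc h ]                               ∎
  where
  iterates-bounded : ∀ {i} → i < h → All (_< h) (iter i φ (0 ∷ 0 ∷ []))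
  iterates-bounded {i} i<h = subst (All (_< h)) (sym (iter-φ-00 i shaped-i)) (++⁺ vi<h vi<h)
    where
    shaped-i : ShapedBelow i
    shaped-i = ShapedBelow-≤ (<⇒≤ i<h) shaped
    vi<h = ++⁺ (All.map (λ x<i → <-trans x<i i<h) (v-bounded i shaped-i)) (i<h ∷ [])

shape : ∀ h → Shape h
shape = <-rec Shape shape-step

shaped-below : ∀ h → ShapedBelow h
shaped-below h {c} _ = shape c

φR-palindrome : ∀ {w} → Palindrome w → φR w ≡ reverse (φ w)
φR-palindrome {w} pal = begin
  φR w                           ≡⟨ cong φR (sym pal) ⟩
  φR (reverse w)                 ≡⟨ sym (reverse-concatMap φ-letter w) ⟩
  reverse (φ w)                  ∎

reverse-∷-++ : ∀ a (x : ℕ) b → reverse (a ++ x ∷ b) ≡ reverse b ++ x ∷ reverse a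
reverse-∷-++ a x b = begin
  reverse (a ++ x ∷ b)              ≡⟨ reverse-++ a (x ∷ b) ⟩
  reverse (x ∷ b) ++ reverse a      ≡⟨ cong (_++ reverse a) (reverse-++ [ x ] b) ⟩
  (reverse b ++ [ x ]) ++ reverse a ≡⟨ ++-assoc (reverse b) [ x ] (reverse a) ⟩
  reverse b ++ x ∷ reverse a        ∎

IterOne : ℕ → Set
IterOne h = iter h φ [ 1 ] ≡ φR (v h) ++ [ suc h ]

module _ {h : ℕ} (pal : Palindrome (v h)) where

  reverse-v-suc : reverse (v (suc h)) ≡ v h ++ h ∷ v h ++ h ∷ reverse (φ (v h))
  reverse-v-suc = begin
    reverse (φ (v h) ++ h ∷ v h ++ h ∷ v h)              ≡⟨ reverse-∷-++ (φ (v h)) h (v h ++ h ∷ v h) ⟩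
    reverse (v h ++ h ∷ v h) ++ h ∷ reverse (φ (v h))
      ≡⟨ cong (_++ h ∷ reverse (φ (v h))) (palindrome-sandwich pal refl) ⟩
    (v h ++ h ∷ v h) ++ h ∷ reverse (φ (v h))            ≡⟨ ++-assoc (v h) (h ∷ v h) _ ⟩
    v h ++ h ∷ v h ++ h ∷ reverse (φ (v h))              ∎

  reverse-φ-letter : reverse (φ-letter h) ≡ suc h ∷ v h ++ h ∷ v h ++ [ h ]
  reverse-φ-letter = begin
    reverse (φ-letter h)
      ≡⟨ cong reverse (trans (shape h) (cong (h ∷_) (sym (++-assoc (v h) _ _)))) ⟩
    reverse ((h ∷ v h ++ h ∷ v h) ++ [ suc h ])  ≡⟨ reverse-++ (h ∷ v h ++ h ∷ v h) [ suc h ] ⟩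
    suc h ∷ reverse (h ∷ v h ++ h ∷ v h)         ≡⟨ cong (suc h ∷_) (reverse-++ [ h ] (v h ++ h ∷ v h)) ⟩
    suc h ∷ reverse (v h ++ h ∷ v h) ++ [ h ]    ≡⟨ cong (λ w → suc h ∷ w ++ [ h ]) (palindrome-sandwich pal refl) ⟩
    suc h ∷ (v h ++ h ∷ v h) ++ [ h ]            ≡⟨ cong (suc h ∷_) (++-assoc (v h) _ _) ⟩
    suc h ∷ v h ++ h ∷ v h ++ [ h ]              ∎

  palindrome-v-suc : IterOne h → Palindrome (v (suc h))
  palindrome-v-suc iterOne = trans reverse-v-suc (sym (∷ʳ-injectiveˡ _ _ two-factorisations))
    where
    two-factorisations : v (suc h) ++ [ suc h ] ≡ (v h ++ h ∷ v h ++ h ∷ reverse (φ (v h))) ++ [ suc h ]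
    two-factorisations = begin
      v (suc h) ++ [ suc h ]                        ≡⟨ sym (iter-φ-0 (suc h) (shaped-below (suc h))) ⟩
      φ (iter h φ [ 0 ])                            ≡⟨ sym (iter-commute h φ [ 0 ]) ⟩
      iter h φ (φ [ 0 ])                            ≡⟨ cong (iter h φ) (trans φ-[ 0 ] (shape 0)) ⟩
      iter h φ ([ 0 ] ++ [ 0 ] ++ [ 1 ])
        ≡⟨ trans (iter-φ-++ h [ 0 ] _) (cong (iter h φ [ 0 ] ++_) (iter-φ-++ h [ 0 ] [ 1 ])) ⟩
      iter h φ [ 0 ] ++ iter h φ [ 0 ] ++ iter h φ [ 1 ]
        ≡⟨ cong₂ (λ a b → a ++ a ++ b) (iter-φ-0 h (shaped-below h)) (trans iterOne (cong (_++ [ suc h ]) (φR-palindrome pal))) ⟩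
      (v h ++ [ h ]) ++ (v h ++ [ h ]) ++ (reverse (φ (v h)) ++ [ suc h ])
        ≡⟨ solve 4 (λ a b c d → (a ⊕ b) ⊕ (a ⊕ b) ⊕ (c ⊕ d) ⊜ (a ⊕ b ⊕ a ⊕ b ⊕ c) ⊕ d)
             refl (v h) [ h ] (reverse (φ (v h))) [ suc h ] ⟩
      (v h ++ h ∷ v h ++ h ∷ reverse (φ (v h))) ++ [ suc h ] ∎

  module _ (pal′ : Palindrome (v (suc h))) where

    φ∘reverse∘φ-palindrome : Palindrome (φ (reverse (φ-letter h)))
    φ∘reverse∘φ-palindrome = subst Palindrome (sym expand)
      (palindrome-sandwich {[ suc h ]} refl (palindrome-sandwich {x = [ suc (suc h) ]} t-palindrome refl))
      where
      t = v (suc h) ++ [ suc h ] ++ v (suc h)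
      t-palindrome : Palindrome t
      t-palindrome = palindrome-sandwich {x = [ suc h ]} pal′ refl
      expand : φ (reverse (φ-letter h)) ≡ [ suc h ] ++ (t ++ [ suc (suc h) ] ++ t) ++ [ suc h ]
      expand = begin
        φ (reverse (φ-letter h))                            ≡⟨ cong φ reverse-φ-letter ⟩
        φ-letter (suc h) ++ φ (v h ++ h ∷ v h ++ [ h ])
          ≡⟨ cong (φ-letter (suc h) ++_)
               (trans (cong φ (sym (++-assoc (v h) [ h ] _))) (φ-++ (v h ++ [ h ]) (v h ++ [ h ]))) ⟩
        φ-letter (suc h) ++ φ (v h ++ [ h ]) ++ φ (v h ++ [ h ])
          ≡⟨ cong₂ (λ a b → a ++ b ++ b) (shape (suc h)) (φ-v-∷ʳ (shape h)) ⟩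
        (suc h ∷ v (suc h) ++ suc h ∷ v (suc h) ++ [ suc (suc h) ]) ++ (v (suc h) ++ [ suc h ]) ++ (v (suc h) ++ [ suc h ])
          ≡⟨ solve 3 (λ a d e → (d ⊕ a ⊕ d ⊕ a ⊕ e) ⊕ (a ⊕ d) ⊕ (a ⊕ d) ⊜ d ⊕ ((a ⊕ d ⊕ a) ⊕ e ⊕ (a ⊕ d ⊕ a)) ⊕ d)
               refl (v (suc h)) [ suc h ] [ suc (suc h) ] ⟩
        [ suc h ] ++ (t ++ [ suc (suc h) ] ++ t) ++ [ suc h ] ∎

    iterOne-suc : φ (φR (v h)) ≡ φR (φ (v h)) → IterOne h → IterOne (suc h)
    iterOne-suc commutes iterOne = begin
      φ (iter h φ [ 1 ])                                        ≡⟨ cong φ iterOne ⟩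
      φ (φR (v h) ++ [ suc h ])                                 ≡⟨ φ-++ (φR (v h)) [ suc h ] ⟩
      φ (φR (v h)) ++ φ [ suc h ]
        ≡⟨ cong₂ _++_ commutes (trans φ-[ suc h ] (shape (suc h))) ⟩
      φR A ++ suc h ∷ v (suc h) ++ suc h ∷ v (suc h) ++ [ suc (suc h) ]
        ≡⟨ cong (λ w → φR A ++ suc h ∷ w ++ suc h ∷ w ++ [ suc (suc h) ]) (trans (sym pal′) reverse-v-suc) ⟩
      φR A ++ suc h ∷ X ++ suc h ∷ X ++ [ suc (suc h) ]
        ≡⟨ solve 6 (λ p b c r d e →
             p ⊕ d ⊕ (b ⊕ c ⊕ b ⊕ c ⊕ r) ⊕ d ⊕ (b ⊕ c ⊕ b ⊕ c ⊕ r) ⊕ e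
             ⊜ (p ⊕ (d ⊕ b ⊕ c ⊕ b ⊕ c) ⊕ r ⊕ (d ⊕ b ⊕ c ⊕ b ⊕ c) ⊕ r) ⊕ e)
           refl (φR A) (v h) [ h ] (reverse A) [ suc h ] [ suc (suc h) ] ⟩
      (φR A ++ (suc h ∷ v h ++ h ∷ v h ++ [ h ]) ++ reverse A ++ (suc h ∷ v h ++ h ∷ v h ++ [ h ]) ++ reverse A) ++ [ suc (suc h) ]
        ≡⟨ sym (cong₂ (λ r a → (φR A ++ r ++ a ++ r ++ a) ++ [ suc (suc h) ]) reverse-φ-letter (φR-palindrome pal)) ⟩
      (φR A ++ reverse (φ-letter h) ++ φR (v h) ++ reverse (φ-letter h) ++ φR (v h)) ++ [ suc (suc h) ]
        ≡⟨ sym (cong (_++ [ suc (suc h) ])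
                 (trans (φR-++ A _) (cong (λ w → φR A ++ reverse (φ-letter h) ++ w) (φR-++ (v h) (h ∷ v h))))) ⟩
      φR (v (suc h)) ++ [ suc (suc h) ]                         ∎
      where
      A = φ (v h)
      X = v h ++ h ∷ v h ++ h ∷ reverse A

palindrome-v×iterOne : ∀ h → Palindrome (v h) × IterOne h
palindrome-v×iterOne = <-rec _ step
  where
  step : ∀ h → (∀ {i} → i < h → Palindrome (v i) × IterOne i) → Palindrome (v h) × IterOne h
  step zero _ = refl , refl
  step (suc h) rec = pal′ , iterOne-suc pal pal′ commutes iterOne
    where
    pal = proj₁ (rec (n<1+n h))
    iterOne = proj₂ (rec (n<1+n h))
    pal′ = palindrome-v-suc pal iterOne
    commutes = morphism-commutes-with-reversal φ-letter (v h)
      (All.map (λ c<h → φ∘reverse∘φ-palindrome (proj₁ (rec (m<n⇒m<1+n c<h))) (proj₁ (rec (s≤s c<h))))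
        (v-bounded h (shaped-below h)))

palindrome-v : ∀ h → Palindrome (v h)
palindrome-v h = proj₁ (palindrome-v×iterOne h)

corollary16 : (w : Word) → φ (φR w) ≡ φR (φ w)
corollary16 w = morphism-commutes-with-reversal φ-letter w
  (All.universal (λ c → φ∘reverse∘φ-palindrome (palindrome-v c) (palindrome-v (suc c))) w)
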